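{- Let $p$ be a positive integer. The number of stable monomial ideals $J\triangleleft\mathbf k[x_1,x_2]$ with constant affine Hilbert polynomial equal to $p$ is $\sum_{i=1}^{h}Q(p,i)$, where $h=\left\lfloor\frac{ -1+\sqrt{1+8p}}{2}\right\rfloor$ and $Q(p,i)$ is the number of integer partitions of $p$ into $i$ distinct positive parts.
   Context: $\mathbf k$ is a field of characteristic $0$, $x_1<x_2$. A monomial ideal $J$ is stable if for every term $\tau\in J$ and every variable $x_j>\min(\tau)$ (the smallest variable dividing $\tau$), $x_j\tau/\min(\tau)\in J$. The affine Hilbert function of $J$ is $d\mapsto\dim_{\mathbf k}\mathcal P(d)/J(d)$, with $\mathcal P(d)$ the polynomials of degree $\le d$ and $J(d)=J\cap\mathcal P(d)$; the affine Hilbert polynomial is the polynomial agreeing with it for all large $d$. -}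

module Defs where

open import Data.Nat using (ℕ; zero; suc; _+_; _*_; _∸_; _≤_; _<_; _≡ᵇ_; _<ᵇ_)
open import Data.Bool using (Bool; true; false; if_then_else_; _∧_)
open import Data.Nat.ListAction using (sum)
open import Data.List using (List; []; _∷_; map; upTo; concatMap; length; filterᵇ)
open import Data.Product using (Σ; _×_; ∃)
open import Relation.Binary.PropositionalEquality using (_≡_)
open import Relation.Nullary using (¬_)
open import Data.List.Relation.Unary.All using (All)
open import Data.List.Relation.Unary.Any using (Any)
open import Data.List.Relation.Unary.AllPairs using (AllPairs)

-- A monomial ideal of k[x₁,x₂] is represented by its set of monomials:
-- J a b ≡ true  iff  x₁^a x₂^b ∈ J.
MonSet : Set
MonSet = ℕ → ℕ → Bool

IsMonomialIdeal : MonSet → Set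
IsMonomialIdeal J = ∀ a b → J a b ≡ true → (J (suc a) b ≡ true) × (J a (suc b) ≡ true)

-- stable (x₁ < x₂): if x₁ divides τ = x₁^(a+1) x₂^b ∈ J (so min τ = x₁),
-- then x₂ τ / x₁ ∈ J; if min τ = x₂ there is no larger variable.
IsStable : MonSet → Set
IsStable J = ∀ a b → J (suc a) b ≡ true → J a (suc b) ≡ true

-- affine Hilbert function: number of monomials of degree ≤ d not in J
-- (= dim P(d)/J(d) for a monomial ideal J)
affineHF : MonSet → ℕ → ℕ
affineHF J d =
  sum (map (λ a → sum (map (λ b → if J a b then 0 else 1) (upTo (suc (d ∸ a)))))
           (upTo (suc d)))

HasConstantHP : MonSet → ℕ → Set
HasConstantHP J p = ∃ λ d₀ → ∀ d → d₀ ≤ d → affineHF J d ≡ p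

allLists : ℕ → ℕ → List (List ℕ)
allLists zero p = [] ∷ []
allLists (suc i) p = concatMap (λ x → map (x ∷_) (allLists i p)) (upTo (suc p))

allPositive : List ℕ → Bool
allPositive [] = true
allPositive (x ∷ xs) = (0 <ᵇ x) ∧ allPositive xs

strictlyDecreasing : List ℕ → Bool
strictlyDecreasing [] = true
strictlyDecreasing (x ∷ []) = true
strictlyDecreasing (x ∷ y ∷ xs) = (y <ᵇ x) ∧ strictlyDecreasing (y ∷ xs)

-- Q p i : number of partitions of p into i distinct positive parts
-- (each such partition is listed uniquely as a strictly decreasing list)
Q : ℕ → ℕ → ℕ
Q p i = length (filterᵇ (λ l → allPositive l ∧ strictlyDecreasing l ∧ (sum l ≡ᵇ p))
                        (allLists i p))

sumQ : ℕ → ℕ → ℕ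
sumQ p h = sum (map (λ i → Q p (suc i)) (upTo h))

Counted : ℕ → MonSet → Set
Counted p J = IsMonomialIdeal J × IsStable J × HasConstantHP J p

_≐_ : MonSet → MonSet → Set
J ≐ K = ∀ a b → J a b ≡ K a b

-- "the number of monomial ideals J with property P is N":
-- there is a duplicate-free list of length N of such ideals containing every one.
NumberOf : (MonSet → Set) → ℕ → Set
NumberOf P N = Σ (List MonSet) λ L →
  (length L ≡ N) × All P L × AllPairs (λ J K → ¬ (J ≐ K)) L
  × (∀ J → P J → Any (λ K → J ≐ K) L)

{-# OPTIONS --safe #-}
-- A monomial ideal J of k[x₁,x₂] is the staircase {x₁^a x₂^b : a ≥ r_b}, where r_b is the
-- number of standard monomials in row b. The ideal property makes (r_b) non-increasing, and
-- stability makes it strictly decreasing while positive. If J is stable with constant Hilbert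
-- polynomial p, it contains every monomial of degree ≥ p: when x₁^a x₂^b ∉ J, stability and
-- the ideal property keep 1, x₁, …, x₁^(a+b) outside J, so the Hilbert function exceeds a + b.
-- So only finitely many r_b are positive, they add up to p, and J ↦ (r_b) is a bijection onto
-- the partitions of p into distinct parts. Such a partition with i parts has i(i+1)/2 ≤ p,
-- that is i ≤ h.

module Submission where

open import Defs
open import Algebra.Properties.CommutativeSemigroup using (interchange)
open import Data.Bool using (Bool; true; false; T; _∧_; if_then_else_)
open import Data.Bool.Properties using (T-∧; T-≡) renaming (_≟_ to _≟ᵇ_)
open import Data.Empty using (⊥-elim)
open import Data.List using (List; []; _∷_; map; upTo; applyUpTo; concatMap; length; filterᵇ)
open import Data.List.Membership.Propositional using (_∈_)
open import Data.List.Membership.Propositional.Properties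
  using (∈-map⁻; ∈-concatMap⁺; ∈-concatMap⁻; ∈-upTo⁺; ∈-filter⁺; ∈-filter⁻)
open import Data.List.Properties using (length-++; length-map; map-cong; ∷-injective)
open import Data.List.Relation.Unary.All as All using (All; []; _∷_)
import Data.List.Relation.Unary.All.Properties as All
open import Data.List.Relation.Unary.AllPairs as AllPairs using (AllPairs; []; _∷_)
import Data.List.Relation.Unary.AllPairs.Properties as AllPairs
open import Data.List.Relation.Unary.Any as Any using (here; there)
import Data.List.Relation.Unary.Any.Properties as Any
open import Data.List.Relation.Unary.Linked as Linked using (Linked; []; [-]; _∷_)
open import Data.List.Relation.Unary.Unique.Propositional using (Unique)
import Data.List.Relation.Unary.Unique.Propositional.Properties as Unique
open import Data.Nat
  using (ℕ; zero; suc; _+_; _*_; _∸_; _≤_; _<_; _>_; _≤ᵇ_; _≡ᵇ_; z≤n; s≤s; z<s; _≤′_; ≤′-refl; ≤′-step)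
open import Data.Nat.ListAction using (sum)
open import Data.Nat.Properties
open import Data.Nat.Tactic.RingSolver using (solve-∀)
open import Data.Product using (∃; _×_; _,_; proj₁; proj₂)
open import Data.Product.Function.NonDependent.Propositional using (_×-⇔_)
open import Function using (_∘_; id; _⇔_; mk⇔; Equivalence)
open import Function.Construct.Composition using (_⇔-∘_)
open import Relation.Binary.PropositionalEquality
open import Relation.Nullary.Decidable using (T?; decidable-stable)

sumBelow : ℕ → (ℕ → ℕ) → ℕ
sumBelow zero    f = 0
sumBelow (suc n) f = f 0 + sumBelow n (f ∘ suc)

sum-map-applyUpTo : ∀ n (g f : ℕ → ℕ) → sum (map f (applyUpTo g n)) ≡ sumBelow n (f ∘ g)
sum-map-applyUpTo zero    g f = refl
sum-map-applyUpTo (suc n) g f = cong (f (g 0) +_) (sum-map-applyUpTo n (g ∘ suc) f)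

sum-map-upTo : ∀ n f → sum (map f (upTo n)) ≡ sumBelow n f
sum-map-upTo n = sum-map-applyUpTo n id

sumBelow-cong : ∀ n {f g} → (∀ i → i < n → f i ≡ g i) → sumBelow n f ≡ sumBelow n g
sumBelow-cong zero    f≡g = refl
sumBelow-cong (suc n) f≡g =
  cong₂ _+_ (f≡g 0 z<s) (sumBelow-cong n (λ i i<n → f≡g (suc i) (s≤s i<n)))

sumBelow-const : ∀ n k → sumBelow n (λ _ → k) ≡ n * k
sumBelow-const zero    k = refl
sumBelow-const (suc n) k = cong (k +_) (sumBelow-const n k)

sumBelow-zero : ∀ n → sumBelow n (λ _ → 0) ≡ 0
sumBelow-zero n = trans (sumBelow-const n 0) (*-zeroʳ n)

sumBelow-+ : ∀ n f g → sumBelow n (λ i → f i + g i) ≡ sumBelow n f + sumBelow n g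
sumBelow-+ zero    f g = refl
sumBelow-+ (suc n) f g = trans
  (cong (f 0 + g 0 +_) (sumBelow-+ n (f ∘ suc) (g ∘ suc)))
  (interchange +-commutativeSemigroup (f 0) (g 0) _ _)

sumBelow-mono-≤ : ∀ {m n f g} → m ≤ n → (∀ i → f i ≤ g i) → sumBelow m f ≤ sumBelow n g
sumBelow-mono-≤ z≤n       f≤g = z≤n
sumBelow-mono-≤ (s≤s m≤n) f≤g = +-mono-≤ (f≤g 0) (sumBelow-mono-≤ m≤n (f≤g ∘ suc))

sumBelow-triangle : ∀ d (F : ℕ → ℕ → ℕ) →
  sumBelow (2 + d) (λ a → sumBelow (suc d ∸ a) (F a)) ≡
  sumBelow (suc d) (λ a → sumBelow (suc (d ∸ a)) (F a))
sumBelow-triangle zero    F = cong (sumBelow 1 (F 0) +_) (+-identityʳ _)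
sumBelow-triangle (suc d) F = cong (sumBelow (2 + d) (F 0) +_) (sumBelow-triangle d (F ∘ suc))

outside : Bool → ℕ
outside b = if b then 0 else 1

outside-≢true : ∀ {x} → x ≢ true → outside x ≡ 1
outside-≢true {false} _      = refl
outside-≢true {true}  x≢true = ⊥-elim (x≢true refl)

affineHF′ : MonSet → ℕ → ℕ
affineHF′ J d = sumBelow (suc d) (λ a → sumBelow (suc (d ∸ a)) (λ b → outside (J a b)))

affineHF≡affineHF′ : ∀ J d → affineHF J d ≡ affineHF′ J d
affineHF≡affineHF′ J d = trans
  (sum-map-upTo (suc d) (λ a → sum (map (λ b → outside (J a b)) (upTo (suc (d ∸ a))))))
  (sumBelow-cong (suc d) (λ a _ → sum-map-upTo (suc (d ∸ a)) (λ b → outside (J a b))))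

affineHF-cong : ∀ {J K} d → J ≐ K → affineHF J d ≡ affineHF K d
affineHF-cong d J≐K = cong sum (map-cong
  (λ a → cong sum (map-cong (λ b → cong outside (J≐K a b)) (upTo (suc (d ∸ a)))))
  (upTo (suc d)))

colonX₂ : MonSet → MonSet
colonX₂ J a b = J a (suc b)

affineHF′-suc : ∀ J d →
  affineHF′ J (suc d) ≡ sumBelow (2 + d) (λ a → outside (J a 0)) + affineHF′ (colonX₂ J) d
affineHF′-suc J d = trans
  (sumBelow-+ (2 + d) row₀ (λ a → sumBelow (suc d ∸ a) (λ b → outside (J a (suc b)))))
  (cong (sumBelow (2 + d) row₀ +_) (sumBelow-triangle d (λ a b → outside (J a (suc b)))))
  where
  row₀ : ℕ → ℕ
  row₀ a = outside (J a 0)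

x₁-powers≤affineHF′ : ∀ J d → sumBelow (suc d) (λ a → outside (J a 0)) ≤ affineHF′ J d
x₁-powers≤affineHF′ J d = sumBelow-mono-≤ {f = λ a → outside (J a 0)} (≤-refl {suc d})
  (λ a → m≤m+n (outside (J a 0)) (sumBelow (d ∸ a) (λ b → outside (J a (suc b)))))

x₁-powers∉⇒<affineHF : ∀ J {c d} → c ≤ d → (∀ i → i ≤ c → J i 0 ≢ true) → c < affineHF J d
x₁-powers∉⇒<affineHF J {c} {d} c≤d x₁^i∉J = begin
  suc c
    ≡⟨ *-identityʳ (suc c) ⟨
  suc c * 1
    ≡⟨ sumBelow-const (suc c) 1 ⟨
  sumBelow (suc c) (λ _ → 1)
    ≡⟨ sumBelow-cong (suc c) all-outside ⟨
  sumBelow (suc c) (λ i → outside (J i 0))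
    ≤⟨ sumBelow-mono-≤ {f = λ i → outside (J i 0)} (s≤s c≤d) (λ _ → ≤-refl) ⟩
  sumBelow (suc d) (λ i → outside (J i 0))
    ≤⟨ x₁-powers≤affineHF′ J d ⟩
  affineHF′ J d
    ≡⟨ affineHF≡affineHF′ J d ⟨
  affineHF J d
    ∎
  where
  open ≤-Reasoning
  all-outside : ∀ i → i < suc c → outside (J i 0) ≡ 1
  all-outside i i<1+c = outside-≢true (x₁^i∉J i (≤-pred i<1+c))

HasConstantHP-resp : ∀ {J K p} → J ≐ K → HasConstantHP J p → HasConstantHP K p
HasConstantHP-resp J≐K (d₀ , hf) = d₀ , λ d d₀≤d → trans (sym (affineHF-cong d J≐K)) (hf d d₀≤d)

HasConstantHP-unique : ∀ {J p q} → HasConstantHP J p → HasConstantHP J q → p ≡ q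
HasConstantHP-unique (d₀ , hp) (d₁ , hq) =
  trans (sym (hp (d₀ + d₁) (m≤m+n d₀ d₁))) (hq (d₀ + d₁) (m≤n+m d₁ d₀))

≤ᵇ≡true⇒≤ : ∀ r a → (r ≤ᵇ a) ≡ true → r ≤ a
≤ᵇ≡true⇒≤ r a = ≤ᵇ⇒≤ r a ∘ Equivalence.from T-≡

≤⇒≤ᵇ≡true : ∀ {r a} → r ≤ a → (r ≤ᵇ a) ≡ true
≤⇒≤ᵇ≡true = Equivalence.to T-≡ ∘ ≤⇒≤ᵇ

≤ᵇ-suc : ∀ r a → (suc r ≤ᵇ suc a) ≡ (r ≤ᵇ a)
≤ᵇ-suc zero    a = refl
≤ᵇ-suc (suc r) a = refl

≤ᵇ-injective : ∀ {r s} → (∀ a → (r ≤ᵇ a) ≡ (s ≤ᵇ a)) → r ≡ s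
≤ᵇ-injective {r} {s} same = ≤-antisym
  (≤ᵇ≡true⇒≤ r s (trans (same s) (≤⇒≤ᵇ≡true (≤-refl {s}))))
  (≤ᵇ≡true⇒≤ s r (trans (sym (same r)) (≤⇒≤ᵇ≡true (≤-refl {r}))))

sumBelow-outside-≤ᵇ : ∀ {r n} → r ≤ n → sumBelow n (λ a → outside (r ≤ᵇ a)) ≡ r
sumBelow-outside-≤ᵇ {zero}  {n}     _         = sumBelow-zero n
sumBelow-outside-≤ᵇ {suc r} {suc n} (s≤s r≤n) = cong suc (trans
  (sumBelow-cong n (λ a _ → cong outside (≤ᵇ-suc r a)))
  (sumBelow-outside-≤ᵇ r≤n))

-- The b-th entry r_b is the number of standard monomials in row b (those x₁^a x₂^b with
-- a < r_b); the rows past the end of the list lie in the ideal.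
staircase : List ℕ → MonSet
staircase []       a b       = true
staircase (r ∷ rs) a zero    = r ≤ᵇ a
staircase (r ∷ rs) a (suc b) = staircase rs a b

-- n + D ≤ d makes the first monomial x₁^(r_b) x₂^b of J in every row have degree ≤ d.
affineHF′-staircase : ∀ l {n D} d → length l ≤ n → All (_≤ D) l → n + D ≤ d →
  affineHF′ (staircase l) d ≡ sum l
affineHF′-staircase [] d _ _ _ =
  trans (sumBelow-cong (suc d) (λ a _ → sumBelow-zero (suc (d ∸ a)))) (sumBelow-zero (suc d))
affineHF′-staircase (r ∷ rs) {suc n} {D} (suc d) (s≤s len≤n) (r≤D ∷ rs≤D) (s≤s n+D≤d) = begin
  affineHF′ (staircase (r ∷ rs)) (suc d)
    ≡⟨ affineHF′-suc (staircase (r ∷ rs)) d ⟩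
  sumBelow (2 + d) (λ a → outside (r ≤ᵇ a)) + affineHF′ (staircase rs) d
    ≡⟨ cong₂ _+_ (sumBelow-outside-≤ᵇ r≤2+d) (affineHF′-staircase rs d len≤n rs≤D n+D≤d) ⟩
  r + sum rs
    ∎
  where
  open ≡-Reasoning
  r≤2+d : r ≤ 2 + d
  r≤2+d = ≤-trans r≤D (≤-trans (m≤n+m D n) (≤-trans n+D≤d (m≤n+m d 2)))

All-≤-sum : ∀ l → All (_≤ sum l) l
All-≤-sum []       = []
All-≤-sum (x ∷ xs) =
  m≤m+n x (sum xs) ∷ All.map (λ y≤ → ≤-trans y≤ (m≤n+m (sum xs) x)) (All-≤-sum xs)

staircase-constantHP : ∀ l → HasConstantHP (staircase l) (sum l)
staircase-constantHP l = length l + sum l , λ d length+sum≤d → trans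
  (affineHF≡affineHF′ (staircase l) d)
  (affineHF′-staircase l d ≤-refl (All-≤-sum l) length+sum≤d)

stable⇒ideal : ∀ {J} → (∀ a b → J a b ≡ true → J (suc a) b ≡ true) → IsStable J → IsMonomialIdeal J
stable⇒ideal x₁-closed stable a b τ∈J = x₁-closed a b τ∈J , stable a b (x₁-closed a b τ∈J)

IsStable-resp : ∀ {J K} → J ≐ K → IsStable J → IsStable K
IsStable-resp J≐K stable a b τ∈K =
  trans (sym (J≐K a (suc b))) (stable a b (trans (J≐K (suc a) b) τ∈K))

ideal-∋1⇒full : ∀ {J} → IsMonomialIdeal J → J 0 0 ≡ true → ∀ a b → J a b ≡ true
ideal-∋1⇒full ideal 1∈J zero    zero    = 1∈J
ideal-∋1⇒full ideal 1∈J zero    (suc b) = proj₂ (ideal 0 b (ideal-∋1⇒full ideal 1∈J 0 b))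
ideal-∋1⇒full ideal 1∈J (suc a) b       = proj₁ (ideal a b (ideal-∋1⇒full ideal 1∈J a b))

ideal-mono₁ : ∀ {J} → IsMonomialIdeal J → ∀ {a a′ b} → a ≤ a′ → J a b ≡ true → J a′ b ≡ true
ideal-mono₁ {J} ideal {a} {b = b} a≤a′ τ∈J = go (≤⇒≤′ a≤a′)
  where
  go : ∀ {a′} → a ≤′ a′ → J a′ b ≡ true
  go ≤′-refl         = τ∈J
  go (≤′-step a≤′a′) = proj₁ (ideal _ b (go a≤′a′))

stable-antidiagonal : ∀ {J} → IsStable J → ∀ a b → J (a + b) 0 ≡ true → J a b ≡ true
stable-antidiagonal {J} stable a zero    τ∈J = subst (λ x → J x 0 ≡ true) (+-identityʳ a) τ∈J
stable-antidiagonal {J} stable a (suc b) τ∈J = stable a b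
  (stable-antidiagonal {J} stable (suc a) b (subst (λ x → J x 0 ≡ true) (+-suc a b) τ∈J))

staircase-x₁-closed : ∀ l a b → staircase l a b ≡ true → staircase l (suc a) b ≡ true
staircase-x₁-closed []       a b       _   = refl
staircase-x₁-closed (r ∷ rs) a zero    r≤a = ≤⇒≤ᵇ≡true (m≤n⇒m≤1+n (≤ᵇ≡true⇒≤ r a r≤a))
staircase-x₁-closed (r ∷ rs) a (suc b)     = staircase-x₁-closed rs a b

staircase-stable : ∀ {l} → Linked _>_ l → IsStable (staircase l)
staircase-stable         []        a b       _     = refl
staircase-stable         [-]       a b       _     = refl
staircase-stable {r ∷ _} (s<r ∷ _) a zero    r≤1+a =
  ≤⇒≤ᵇ≡true (≤-pred (≤-trans s<r (≤ᵇ≡true⇒≤ r (suc a) r≤1+a)))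
staircase-stable         (_ ∷ dec) a (suc b)       = staircase-stable dec a b

stable-staircase⇒decreasing : ∀ {l} → All (0 <_) l → IsStable (staircase l) → Linked _>_ l
stable-staircase⇒decreasing                    []        _      = []
stable-staircase⇒decreasing                    (_ ∷ [])  _      = [-]
stable-staircase⇒decreasing {suc r ∷ s ∷ rs} (_ ∷ pos) stable =
  s≤s (≤ᵇ≡true⇒≤ s r (stable r 0 (≤⇒≤ᵇ≡true (≤-refl {suc r})))) ∷
  stable-staircase⇒decreasing pos (λ a b → stable a (suc b))

staircase-injective : ∀ {l l′} → All (0 <_) l → All (0 <_) l′ → staircase l ≐ staircase l′ → l ≡ l′
staircase-injective []            []            _    = refl
staircase-injective []            (s≤s z≤n ∷ _) same with same 0 0
... | ()
staircase-injective (s≤s z≤n ∷ _) []            same with same 0 0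
... | ()
staircase-injective (_ ∷ pos)     (_ ∷ pos′)    same = cong₂ _∷_
  (≤ᵇ-injective (λ a → same a 0))
  (staircase-injective pos pos′ (λ a b → same a (suc b)))

_⊇𝔪^_ : MonSet → ℕ → Set
J ⊇𝔪^ c = ∀ a b → c ≤ a + b → J a b ≡ true

upClosed⇒threshold : ∀ D (f : ℕ → Bool) → (∀ a → f a ≡ true → f (suc a) ≡ true) →
  (∀ a → D ≤ a → f a ≡ true) → ∃ λ r → ∀ a → f a ≡ (r ≤ᵇ a)
upClosed⇒threshold zero    f up full = 0 , λ a → full a z≤n
upClosed⇒threshold (suc D) f up full with f 0 in f0≡
... | true  = 0 , all-true
  where
  all-true : ∀ a → f a ≡ true
  all-true zero    = f0≡
  all-true (suc a) = up a (all-true a)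
... | false with upClosed⇒threshold D (f ∘ suc) (up ∘ suc) (λ a D≤a → full (suc a) (s≤s D≤a))
...   | r , f∘suc≡ = suc r , λ where
  zero    → f0≡
  (suc a) → trans (f∘suc≡ a) (sym (≤ᵇ-suc r a))

threshold-positive : ∀ {f : ℕ → Bool} {r} → (∀ a → f a ≡ (r ≤ᵇ a)) → f 0 ≡ false → 0 < r
threshold-positive {r = zero}  f≡ f0≡false with trans (sym (f≡ 0)) f0≡false
... | ()
threshold-positive {r = suc r} _  _ = z<s

cofinite⇒staircase : ∀ c {J} → IsMonomialIdeal J → J ⊇𝔪^ c →
  ∃ λ l → All (0 <_) l × J ≐ staircase l
cofinite⇒staircase zero          ideal J⊇𝔪^0 = [] , [] , λ a b → J⊇𝔪^0 a b z≤n
cofinite⇒staircase (suc c) {J} ideal J⊇𝔪^1+c with J 0 0 in J00≡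
... | true  = [] , [] , ideal-∋1⇒full ideal J00≡
... | false
  with upClosed⇒threshold (suc c) (λ a → J a 0) (λ a → proj₁ ∘ ideal a 0)
         (λ a 1+c≤a → J⊇𝔪^1+c a 0 (≤-trans 1+c≤a (m≤m+n a 0)))
     | cofinite⇒staircase c (λ a b → ideal a (suc b))
         (λ a b c≤a+b → J⊇𝔪^1+c a (suc b) (≤-trans (s≤s c≤a+b) (≤-reflexive (sym (+-suc a b)))))
... | r , row₀ | l , positive , rows = r ∷ l , threshold-positive row₀ J00≡ ∷ positive , λ where
  a zero    → row₀ a
  a (suc b) → rows a b

stableIdeal⊇𝔪^ : ∀ {J p} → IsMonomialIdeal J → IsStable J → HasConstantHP J p → J ⊇𝔪^ p
stableIdeal⊇𝔪^ {J} ideal stable (d₀ , hf) a b p≤a+b = decidable-stable (J a b ≟ᵇ true) λ τ∉J →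
  <-irrefl refl (≤-trans
    (x₁-powers∉⇒<affineHF J (m≤n+m (a + b) d₀) (λ i i≤a+b x₁^i∈J →
      τ∉J (stable-antidiagonal {J} stable a b (ideal-mono₁ ideal i≤a+b x₁^i∈J))))
    (≤-trans (≤-reflexive (hf (d₀ + (a + b)) (m≤m+n d₀ (a + b)))) p≤a+b))

IsStrictPartition : ℕ → List ℕ → Set
IsStrictPartition p l = All (0 <_) l × Linked _>_ l × sum l ≡ p

staircase-counted : ∀ {p l} → IsStrictPartition p l → Counted p (staircase l)
staircase-counted {l = l} (_ , decreasing , refl) =
  stable⇒ideal (staircase-x₁-closed l) (staircase-stable decreasing) ,
  staircase-stable decreasing ,
  staircase-constantHP l

counted⇒staircase : ∀ {p J} → Counted p J → ∃ λ l → IsStrictPartition p l × J ≐ staircase l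
counted⇒staircase {p} {J} (ideal , stable , hp)
  with cofinite⇒staircase p ideal (stableIdeal⊇𝔪^ {J} ideal stable hp)
... | l , positive , J≐ = l , (positive , decreasing , sum≡p) , J≐
  where
  decreasing : Linked _>_ l
  decreasing = stable-staircase⇒decreasing positive (IsStable-resp {J} J≐ stable)
  sum≡p : sum l ≡ p
  sum≡p = HasConstantHP-unique {staircase l} (staircase-constantHP l) (HasConstantHP-resp J≐ hp)

length≤head : ∀ {x xs} → All (0 <_) (x ∷ xs) → Linked _>_ (x ∷ xs) → length (x ∷ xs) ≤ x
length≤head (0<x ∷ []) [-]         = 0<x
length≤head (_ ∷ pos)  (y<x ∷ dec) = ≤-trans (s≤s (length≤head pos dec)) y<x

length*suc≤2*sum : ∀ {l} → All (0 <_) l → Linked _>_ l → length l * suc (length l) ≤ 2 * sum l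
length*suc≤2*sum {[]}     _              _   = z≤n
length*suc≤2*sum {x ∷ xs} pos@(_ ∷ pos′) dec = begin
  suc m * suc (suc m)   ≡⟨ expand m ⟩
  2 * suc m + m * suc m ≤⟨ +-mono-≤ (*-monoʳ-≤ 2 (length≤head pos dec))
                                   (length*suc≤2*sum pos′ (Linked.tail dec)) ⟩
  2 * x + 2 * sum xs    ≡⟨ *-distribˡ-+ 2 x (sum xs) ⟨
  2 * (x + sum xs)      ∎
  where
  open ≤-Reasoning
  m : ℕ
  m = length xs
  expand : ∀ m → suc m * suc (suc m) ≡ 2 * suc m + m * suc m
  expand = solve-∀

strictPartition-length≤ : ∀ {p h l} → 1 + 8 * p < (2 * h + 3) * (2 * h + 3) →
  IsStrictPartition p l → length l ≤ h
strictPartition-length≤ {p} {h} {l} 8p+1<[2h+3]² (positive , decreasing , refl) =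
  ≮⇒≥ λ h<length → <⇒≱ 8p+1<[2h+3]² (begin
    (2 * h + 3) * (2 * h + 3)     ≡⟨ square h ⟩
    1 + 4 * (suc h * suc (suc h)) ≤⟨ s≤s (*-monoʳ-≤ 4 (≤-trans (*-mono-≤ h<length (s≤s h<length))
                                                                (length*suc≤2*sum positive decreasing))) ⟩
    1 + 4 * (2 * sum l)           ≡⟨ cong suc (times8 (sum l)) ⟩
    1 + 8 * sum l                 ∎)
  where
  open ≤-Reasoning
  square : ∀ h → (2 * h + 3) * (2 * h + 3) ≡ 1 + 4 * (suc h * suc (suc h))
  square = solve-∀
  times8 : ∀ p → 4 * (2 * p) ≡ 8 * p
  times8 = solve-∀

length-concatMap : ∀ {A B : Set} (f : A → List B) xs →
  length (concatMap f xs) ≡ sum (map (length ∘ f) xs)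
length-concatMap f []       = refl
length-concatMap f (x ∷ xs) = trans (length-++ (f x)) (cong (length (f x) +_) (length-concatMap f xs))

concatMap-unique : ∀ {A B : Set} {f : A → List B} {xs} → (∀ x → Unique (f x)) →
  (∀ {x y v} → v ∈ f x → v ∈ f y → x ≡ y) → Unique xs → Unique (concatMap f xs)
concatMap-unique f-unique separated xs-unique = Unique.concat⁺
  (All.map⁺ (All.tabulate (λ {x} _ → f-unique x)))
  (AllPairs.map⁺ (AllPairs.map (λ x≢y {_} (v∈fx , v∈fy) → x≢y (separated v∈fx v∈fy)) xs-unique))

∈-allLists⁺ : ∀ {p} l → All (_≤ p) l → l ∈ allLists (length l) p
∈-allLists⁺ []       []           = here refl
∈-allLists⁺ (x ∷ xs) (x≤p ∷ xs≤p) = ∈-concatMap⁺ _ (Any.map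
  (λ { refl → Any.map⁺ (Any.map (cong (x ∷_)) (∈-allLists⁺ xs xs≤p)) })
  (∈-upTo⁺ (s≤s x≤p)))

∈-allLists⁻ : ∀ {i p l} → l ∈ allLists i p → length l ≡ i
∈-allLists⁻ {zero}      (here refl) = refl
∈-allLists⁻ {suc i} {p} l∈          with Any.satisfied (∈-concatMap⁻ _ {xs = upTo (suc p)} l∈)
... | x , l∈x∷ with ∈-map⁻ (x ∷_) l∈x∷
...   | t , t∈ , refl = cong suc (∈-allLists⁻ t∈)

allLists-unique : ∀ i p → Unique (allLists i p)
allLists-unique zero    p = [] ∷ []
allLists-unique (suc i) p = concatMap-unique
  (λ x → Unique.map⁺ (proj₂ ∘ ∷-injective) (allLists-unique i p))
  same-head
  (Unique.upTo⁺ (suc p))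
  where
  same-head : ∀ {x y v} → v ∈ map (x ∷_) (allLists i p) → v ∈ map (y ∷_) (allLists i p) → x ≡ y
  same-head v∈x∷ v∈y∷ with ∈-map⁻ _ v∈x∷ | ∈-map⁻ _ v∈y∷
  ... | _ , _ , refl | _ , _ , refl = refl

-- The filter used by Q, so that Q p i is by definition the length of strictPartitionsOfLength p i.
isStrictPartitionᵇ : ℕ → List ℕ → Bool
isStrictPartitionᵇ p l = allPositive l ∧ strictlyDecreasing l ∧ (sum l ≡ᵇ p)

T-allPositive : ∀ {l} → T (allPositive l) ⇔ All (0 <_) l
T-allPositive = mk⇔ (to _) from
  where
  to : ∀ l → T (allPositive l) → All (0 <_) l
  to []          _ = []
  to (suc x ∷ l) t = z<s ∷ to l t
  from : ∀ {l} → All (0 <_) l → T (allPositive l)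
  from []          = _
  from (z<s ∷ pos) = from pos

T-strictlyDecreasing : ∀ {l} → T (strictlyDecreasing l) ⇔ Linked _>_ l
T-strictlyDecreasing = mk⇔ (to _) from
  where
  to : ∀ l → T (strictlyDecreasing l) → Linked _>_ l
  to []          _ = []
  to (x ∷ [])    _ = [-]
  to (x ∷ y ∷ l) t =
    <ᵇ⇒< y x (proj₁ (Equivalence.to T-∧ t)) ∷ to (y ∷ l) (proj₂ (Equivalence.to T-∧ t))
  from : ∀ {l} → Linked _>_ l → T (strictlyDecreasing l)
  from []          = _
  from [-]         = _
  from (y<x ∷ dec) = Equivalence.from T-∧ (<⇒<ᵇ y<x , from dec)

T-≡ᵇ : ∀ {m n} → T (m ≡ᵇ n) ⇔ (m ≡ n)
T-≡ᵇ {m} {n} = mk⇔ (≡ᵇ⇒≡ m n) (≡⇒≡ᵇ m n)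

T-isStrictPartitionᵇ : ∀ {p l} → T (isStrictPartitionᵇ p l) ⇔ IsStrictPartition p l
T-isStrictPartitionᵇ = (T-allPositive ×-⇔ ((T-strictlyDecreasing ×-⇔ T-≡ᵇ) ⇔-∘ T-∧)) ⇔-∘ T-∧

strictPartitionsOfLength : ℕ → ℕ → List (List ℕ)
strictPartitionsOfLength p i = filterᵇ (isStrictPartitionᵇ p) (allLists i p)

∈-strictPartitionsOfLength⁻ : ∀ {p i l} → l ∈ strictPartitionsOfLength p i →
  length l ≡ i × IsStrictPartition p l
∈-strictPartitionsOfLength⁻ {p} {i} l∈ with ∈-filter⁻ (T? ∘ isStrictPartitionᵇ p) {xs = allLists i p} l∈
... | l∈allLists , partition = ∈-allLists⁻ l∈allLists , Equivalence.to T-isStrictPartitionᵇ partition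

strictPartitions : ℕ → ℕ → List (List ℕ)
strictPartitions p h = concatMap (strictPartitionsOfLength p ∘ suc) (upTo h)

length-strictPartitions : ∀ p h → length (strictPartitions p h) ≡ sumQ p h
length-strictPartitions p h = length-concatMap (strictPartitionsOfLength p ∘ suc) (upTo h)

strictPartitions-unique : ∀ p h → Unique (strictPartitions p h)
strictPartitions-unique p h = concatMap-unique
  (λ i → Unique.filter⁺ (T? ∘ isStrictPartitionᵇ p) (allLists-unique (suc i) p))
  (λ {i} {j} v∈i v∈j → suc-injective (trans
    (sym (proj₁ (∈-strictPartitionsOfLength⁻ {p} {suc i} v∈i)))
    (proj₁ (∈-strictPartitionsOfLength⁻ {p} {suc j} v∈j))))
  (Unique.upTo⁺ h)

∈-strictPartitions⁻ : ∀ {p h l} → l ∈ strictPartitions p h → IsStrictPartition p l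
∈-strictPartitions⁻ {p} {h} l∈ with Any.satisfied (∈-concatMap⁻ _ {xs = upTo h} l∈)
... | i , l∈i = proj₂ (∈-strictPartitionsOfLength⁻ {p} {suc i} l∈i)

∈-strictPartitions⁺ : ∀ {p h l} → 0 < p → IsStrictPartition p l → length l ≤ h →
  l ∈ strictPartitions p h
∈-strictPartitions⁺ {l = []}            0<p (_ , _ , refl) _ = ⊥-elim (<-irrefl refl 0<p)
∈-strictPartitions⁺ {p} {l = l@(_ ∷ _)} _ partition length≤h = ∈-concatMap⁺ _ (Any.map
  (λ { refl → ∈-filter⁺ (T? ∘ isStrictPartitionᵇ p) (∈-allLists⁺ l parts≤p)
                        (Equivalence.from T-isStrictPartitionᵇ partition) })
  (∈-upTo⁺ length≤h))
  where
  parts≤p : All (_≤ p) l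
  parts≤p = subst (λ s → All (_≤ s) l) (proj₂ (proj₂ partition)) (All-≤-sum l)

AllPairs-map-∈ : ∀ {A : Set} {R S : A → A → Set} {xs} →
  (∀ {x y} → x ∈ xs → y ∈ xs → R x y → S x y) → AllPairs R xs → AllPairs S xs
AllPairs-map-∈ R⇒S []         = []
AllPairs-map-∈ R⇒S (rx ∷ rxs) =
  All.tabulate (λ y∈ → R⇒S (here refl) (there y∈) (All.lookup rx y∈)) ∷
  AllPairs-map-∈ (λ x∈ y∈ → R⇒S (there x∈) (there y∈)) rxs

numberOf-image : ∀ {A : Set} {P : MonSet → Set} (f : A → MonSet) {xs : List A} → Unique xs →
  (∀ {x} → x ∈ xs → P (f x)) →
  (∀ {x y} → x ∈ xs → y ∈ xs → f x ≐ f y → x ≡ y) →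
  (∀ J → P J → ∃ λ x → x ∈ xs × J ≐ f x) →
  NumberOf P (length xs)
numberOf-image f {xs} unique image⊆P injective P⊆image =
  map f xs ,
  length-map f xs ,
  All.map⁺ (All.tabulate image⊆P) ,
  AllPairs.map⁺ (AllPairs-map-∈ (λ x∈ y∈ x≢y fx≐fy → x≢y (injective x∈ y∈ fx≐fy)) unique) ,
  λ J PJ → let (x , x∈ , J≐fx) = P⊆image J PJ in Any.map⁺ (Any.map (λ { refl → J≐fx }) x∈)

mainTheorem8 : (p h : ℕ) → 1 ≤ p
    -- h = ⌊(-1 + √(1+8p))/2⌋ , i.e. (2h+1)² ≤ 1+8p < (2h+3)²
    → (2 * h + 1) * (2 * h + 1) ≤ 1 + 8 * p
    → 1 + 8 * p < (2 * h + 3) * (2 * h + 3)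
    → NumberOf (Counted p) (sumQ p h)
mainTheorem8 p h 0<p _ 8p+1<[2h+3]² =
  subst (NumberOf (Counted p)) (length-strictPartitions p h)
    (numberOf-image staircase (strictPartitions-unique p h)
      (staircase-counted ∘ ∈-strictPartitions⁻ {p} {h})
      (λ l∈ l′∈ → staircase-injective (positive l∈) (positive l′∈))
      classify)
  where
  positive : ∀ {l} → l ∈ strictPartitions p h → All (0 <_) l
  positive = proj₁ ∘ ∈-strictPartitions⁻ {p} {h}
  classify : ∀ J → Counted p J → ∃ λ l → l ∈ strictPartitions p h × J ≐ staircase l
  classify J counted with counted⇒staircase counted
  ... | l , partition , J≐ =
    l ,
    ∈-strictPartitions⁺ {h = h} 0<p partition (strictPartition-length≤ {h = h} 8p+1<[2h+3]² partition) ,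
    J≐
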